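{- Let $P\subseteq\mathbb{R}^d$ be a $d$-dimensional polyhedron with set of circuits $\mathcal{C}(P)$, identified with $P\times\{0\}\subseteq\mathbb{R}^{d+1}$, and let $F$ be a facet of $P$. If $P'$ is a wedge on $P$ over $F$ with cutting hyperplane $H$, then the set of circuits $\mathcal{C}(P')$ consists of vectors of the following forms: (i) $(0,\dots,0,\pm1)^T\in\mathbb{R}^{d+1}$; (ii) $(\pm c,0)^T\in\mathbb{R}^{d+1}$ with $c\in\mathcal{C}(P)$; (iii) $\phi((\pm c,0)^T)\in\mathbb{R}^{d+1}$ with $c\in\mathcal{C}(P)$.
   Context: Polyhedra are given by irredundant full-dimensional inequality systems $Az\ge b$, each row defining a facet; the circuits are the nonzero vectors $g$ such that the support of $Ag$ is inclusion-minimal among supports of $Ax$, $x\ne0$, normalized to coprime integer components. A wedge on $P$ over the facet $F$ is $P'=H^{\le}\cap(P\times[0,\infty))\subset\mathbb{R}^{d+1}$, where $H^{\le}$ is a closed halfspace containing $P\times\{0\}$ whose bounding hyperplane $H$ meets the interior of $P\times[0,\infty)$ and satisfies $H\cap(P\times\{0\})=F\times\{0\}$; $P'$ is described by the inequalities of $P$ (as inequalities in the first $d$ coordinates, except that the one for $F$ is replaced), $x_{d+1}\ge0$, and the inequality of $H^{\le}$. The map $\phi$ sends a vector $(c,0)$ with $c\in\mathbb{R}^d$ to the unique vector $(c,t)\in\mathbb{R}^{d+1}$ parallel to $H$ (i.e. the vertical projection of $(c,0)$ onto the direction space of $H$).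
   Formalization: The polyhedron P and the cutting hyperplane H have rational coefficients, and all points and vectors lie in ℚ^d and ℚ^(d+1) rather than ℝ^d and ℝ^(d+1). -}

module Defs where

open import Data.Nat using (ℕ; zero; suc)
import Data.Nat as ℕ
open import Data.Integer using (ℤ; +_)
import Data.Integer as ℤ
open import Data.Nat.Divisibility using (_∣_)
open import Data.Rational using (ℚ; 0ℚ; 1ℚ; _+_; _*_; _-_; -_; _≤_; _<_; _≥_; _>_; ∣_∣; _/_)
open import Data.Fin using (Fin; zero; suc; _↑ˡ_; _↑ʳ_; splitAt)
open import Data.Sum using (_⊎_; inj₁; inj₂; [_,_]′)
open import Data.Product using (Σ; ∃; _×_; _,_)
open import Relation.Binary.PropositionalEquality using (_≡_)
open import Relation.Nullary using (¬_)

Vec : ℕ → Set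
Vec n = Fin n → ℚ

Mat : ℕ → ℕ → Set
Mat m n = Fin m → Fin n → ℚ

sumF : ∀ {n} → (Fin n → ℚ) → ℚ
sumF {zero}  f = 0ℚ
sumF {suc n} f = f zero + sumF (λ i → f (suc i))

_·_ : ∀ {n} → Vec n → Vec n → ℚ
u · v = sumF (λ i → u i * v i)

_⊛_ : ∀ {m n} → Mat m n → Vec n → Vec m
(A ⊛ x) i = A i · x

_*v_ : ∀ {n} → ℚ → Vec n → Vec n
(λq *v v) i = λq * v i

NonZeroVec : ∀ {n} → Vec n → Set
NonZeroVec v = ∃ λ i → ¬ (v i ≡ 0ℚ)

ZVec : ℕ → Set
ZVec n = Fin n → ℤ

toℚ : ∀ {n} → ZVec n → Vec n
toℚ g i = g i / 1

CoprimeComponents : ∀ {n} → ZVec n → Set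
CoprimeComponents g = ∀ (k : ℕ) → (∀ i → k ∣ ℤ.∣ g i ∣) → k ≡ 1

Support : ∀ {m} → Vec m → Fin m → Set
Support y i = ¬ (y i ≡ 0ℚ)

_⊆_ : ∀ {m} → (Fin m → Set) → (Fin m → Set) → Set
S ⊆ T = ∀ i → S i → T i

IsCircuit : ∀ {m n} → Mat m n → ZVec n → Set
IsCircuit A g =
  NonZeroVec (toℚ g)
  × CoprimeComponents g
  × (∀ (x : Vec _) → NonZeroVec x →
       Support (A ⊛ x) ⊆ Support (A ⊛ toℚ g) →
       Support (A ⊛ toℚ g) ⊆ Support (A ⊛ x))

Polyhedron : ∀ {m n} → Mat m n → Vec m → Vec n → Set
Polyhedron A b z = ∀ i → (A ⊛ z) i ≥ b i

InteriorPoint : ∀ {n} → (Vec n → Set) → Vec n → Set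
InteriorPoint S p = Σ ℚ λ ε → ε > 0ℚ × (∀ q → (∀ i → ∣ q i - p i ∣ < ε) → S q)

FullDimensional : ∀ {m n} → Mat m n → Vec m → Set
FullDimensional A b = ∃ λ p → InteriorPoint (Polyhedron A b) p

Irredundant : ∀ {m n} → Mat m n → Vec m → Set
Irredundant A b = ∀ i → ∃ λ z → (∀ j → ¬ (j ≡ i) → (A ⊛ z) j ≥ b j) × (A ⊛ z) i < b i

FacetPt : ∀ {m n} → Mat m n → Vec m → Fin m → Vec n → Set
FacetPt A b f z = Polyhedron A b z × (A ⊛ z) f ≡ b f

ext : ∀ {d} → Vec d → ℚ → Vec (d ℕ.+ 1)
ext {d} c t i = [ c , (λ _ → t) ]′ (splitAt d i)

fstV : ∀ {d} → Vec (d ℕ.+ 1) → Vec d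
fstV v i = v (i ↑ˡ 1)

lastV : ∀ {d} → Vec (d ℕ.+ 1) → ℚ
lastV {d} v = v (d ↑ʳ zero)

Cylinder : ∀ {m d} → Mat m d → Vec m → Vec (d ℕ.+ 1) → Set
Cylinder A b w = Polyhedron A b (fstV w) × lastV w ≥ 0ℚ

OnH : ∀ {d} → Vec d → ℚ → ℚ → Vec (d ℕ.+ 1) → Set
OnH h η β w = (h · fstV w) + η * lastV w ≡ β

-- hypotheses making H^≤ = { h·z + η t ≤ β } define a wedge on P over F
IsWedgeCut : ∀ {m d} → Mat m d → Vec m → Fin m → Vec d → ℚ → ℚ → Set
IsWedgeCut A b f h η β =
  (NonZeroVec h ⊎ ¬ (η ≡ 0ℚ))
  × (∀ z → Polyhedron A b z → (h · z) ≤ β)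
  × (∀ z → Polyhedron A b z → ((h · z) ≡ β → FacetPt A b f z))
  × (∀ z → FacetPt A b f z → (h · z) ≡ β)
  × (∃ λ w → InteriorPoint (Cylinder A b) w × OnH h η β w)

-- constraint matrix of the wedge P' (written as A' (z,t) ≥ b'):
-- row f is replaced by the row of H^≤, i.e. -(h,η)·(z,t) ≥ -β;
-- the other rows of A act on z; one extra row t ≥ 0 (index m).
wedgeMat : ∀ {m d} → Mat m d → Fin m → Vec d → ℚ → Mat (m ℕ.+ 1) (d ℕ.+ 1)
wedgeMat {m} {d} A f h η r =
  [ (λ i → rowFor i) , (λ _ → ext (λ _ → 0ℚ) 1ℚ) ]′ (splitAt m r)
  where
  rowFor : Fin m → Vec (d ℕ.+ 1)
  rowFor i with Data.Fin._≟_ i f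
  ... | Relation.Nullary.yes _ = ext (λ k → - h k) (- η)
  ... | Relation.Nullary.no  _ = ext (A i) 0ℚ

wedgeRhs : ∀ {m} → Vec m → Fin m → ℚ → Vec (m ℕ.+ 1)
wedgeRhs {m} b f β r =
  [ (λ i → rhsFor i) , (λ _ → 0ℚ) ]′ (splitAt m r)
  where
  rhsFor : Fin m → ℚ
  rhsFor i with Data.Fin._≟_ i f
  ... | Relation.Nullary.yes _ = - β
  ... | Relation.Nullary.no  _ = b i

IsSign : ℚ → Set
IsSign σ = σ ≡ 1ℚ ⊎ σ ≡ - 1ℚ

_≐_ : ∀ {n} → Vec n → Vec n → Set
u ≐ v = ∀ i → u i ≡ v i

-- w = φ((c,0)) : the vector (c,t) parallel to H, i.e. h·c + η t = 0
IsPhi : ∀ {d} → Vec d → ℚ → Vec d → Vec (d ℕ.+ 1) → Set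
IsPhi h η c w = ∃ λ t → (h · c) + η * t ≡ 0ℚ × w ≐ ext c t

-- Write a for the facet normal (row f of A) and (h, η) for the normal of H. A point of P violating
-- only the facet inequality (irredundancy) together with an interior point of P shows that H ∩ P = F
-- pins h down up to a nonzero factor: h and a have the same kernel. A point of H interior to
-- P × [0, ∞) then forces η ≠ 0. Consequently, on vectors (x, 0) and on vectors parallel to H, the
-- supports in the wedge system mirror the supports of A x, so minimality transfers between P' and P.
-- For a circuit g = (c, t) of P': if t = 0 then c is a circuit of P; if c = 0 coprimality gives
-- t = ±1; otherwise the lift (η c, -h · c) of c parallel to H has support inside that of g, so by
-- minimality g itself is parallel to H, i.e. a positive multiple of φ((c₀, 0)) for the primitive
-- part c₀ of c, which is a circuit of P.

module Submission where

open import Defs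
open import Data.Nat using (ℕ; zero; suc)
import Data.Nat as ℕ
import Data.Nat.Properties as ℕₚ
open import Data.Nat.Divisibility using (_∣_; divides; ∣-refl; ∣-trans; ∣1⇒≡1; 0∣⇒≡0; *-monoˡ-∣; *-cancelʳ-∣)
open import Data.Nat.GCD using (gcd; gcd[m,n]∣m; gcd[m,n]∣n; gcd-greatest)
open import Data.Nat.Coprimality using (1-coprimeTo)
import Data.Nat.Coprimality as Coprimality
open import Data.Integer using (ℤ; -[1+_])
import Data.Integer as ℤ
import Data.Integer.Properties as ℤₚ
import Data.Integer.Divisibility.Signed as ℤ∣
open import Data.Fin using (Fin; zero; suc; _↑ˡ_; _↑ʳ_; splitAt; join)
import Data.Fin as Fin
open import Data.Fin.Properties using (splitAt-↑ˡ; splitAt-↑ʳ; join-splitAt; any?)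
open import Data.Rational
  using (ℚ; mkℚ; 0ℚ; 1ℚ; _+_; _*_; _-_; -_; _≤_; _<_; _≥_; _>_; ∣_∣; _/_; 1/_; ↥_;
         positive; nonNegative; ≢-nonZero)
open import Data.Rational.Properties
open import Data.Rational.Solver using (module +-*-Solver)
open import Data.Sum using (_⊎_; inj₁; inj₂)
open import Data.Product using (Σ; ∃; _×_; _,_; proj₁; proj₂)
open import Data.Empty using (⊥; ⊥-elim)
open import Function using (_∘′_)
open import Relation.Binary.PropositionalEquality
open import Relation.Nullary using (¬_; yes; no)
open import Relation.Nullary.Decidable using (¬?; decidable-stable)
open +-*-Solver

p>0⇒p≢0 : ∀ {p} → p > 0ℚ → ¬ p ≡ 0ℚ
p>0⇒p≢0 p>0 refl = <-irrefl refl p>0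

≢0-resp-≡ : ∀ {p q} → p ≡ q → ¬ p ≡ 0ℚ → ¬ q ≡ 0ℚ
≢0-resp-≡ p≡q p≢0 q≡0 = p≢0 (trans p≡q q≡0)

*-cancelˡ-≡0 : ∀ {p q} → ¬ p ≡ 0ℚ → p * q ≡ 0ℚ → q ≡ 0ℚ
*-cancelˡ-≡0 {p} {q} p≢0 pq≡0 = begin
  q                ≡⟨ sym (*-identityˡ q) ⟩
  1ℚ * q           ≡⟨ cong (_* q) (sym (*-inverseˡ p)) ⟩
  1/ p * p * q     ≡⟨ *-assoc (1/ p) p q ⟩
  1/ p * (p * q)   ≡⟨ cong (1/ p *_) pq≡0 ⟩
  1/ p * 0ℚ        ≡⟨ *-zeroʳ (1/ p) ⟩
  0ℚ               ∎
  where
  open ≡-Reasoning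
  instance _ = ≢-nonZero p≢0

*-≢0 : ∀ {p q} → ¬ p ≡ 0ℚ → ¬ q ≡ 0ℚ → ¬ p * q ≡ 0ℚ
*-≢0 p≢0 q≢0 pq≡0 = q≢0 (*-cancelˡ-≡0 p≢0 pq≡0)

p<q⇒0<q-p : ∀ {p q} → p < q → 0ℚ < q - p
p<q⇒0<q-p {p} {q} p<q = subst (_< q - p) (+-inverseʳ p) (+-monoˡ-< (- p) p<q)

p≤q⇒0≤q-p : ∀ {p q} → p ≤ q → 0ℚ ≤ q - p
p≤q⇒0≤q-p {p} {q} p≤q = subst (_≤ q - p) (+-inverseʳ p) (+-monoˡ-≤ (- p) p≤q)

-≢0 : ∀ {q} → ¬ q ≡ 0ℚ → ¬ - q ≡ 0ℚ
-≢0 q≢0 -q≡0 = q≢0 (neg-injective -q≡0)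

-≢0⁻ : ∀ {q} → ¬ - q ≡ 0ℚ → ¬ q ≡ 0ℚ
-≢0⁻ -q≢0 q≡0 = -q≢0 (cong -_ q≡0)

+≡0⇒-≡ : ∀ {p q} → p + q ≡ 0ℚ → - p ≡ q
+≡0⇒-≡ {p} {q} p+q≡0 = begin
  - p              ≡⟨ sym (+-identityˡ (- p)) ⟩
  0ℚ - p           ≡⟨ cong (_- p) (sym p+q≡0) ⟩
  p + q - p        ≡⟨ solve 2 (λ p q → p :+ q :- p := q) refl p q ⟩
  q                ∎
  where open ≡-Reasoning

sumF-cong : ∀ {n} {f g : Fin n → ℚ} → (∀ i → f i ≡ g i) → sumF f ≡ sumF g
sumF-cong {zero}  f≗g = refl
sumF-cong {suc n} f≗g = cong₂ _+_ (f≗g zero) (sumF-cong (λ i → f≗g (suc i)))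

sumF-+ : ∀ {n} (f g : Fin n → ℚ) → sumF (λ i → f i + g i) ≡ sumF f + sumF g
sumF-+ {zero}  f g = refl
sumF-+ {suc n} f g =
  trans (cong (f zero + g zero +_) (sumF-+ (λ i → f (suc i)) (λ i → g (suc i))))
        (solve 4 (λ a b c d → (a :+ b) :+ (c :+ d) := (a :+ c) :+ (b :+ d)) refl (f zero) (g zero) _ _)

sumF-*ˡ : ∀ {n} (k : ℚ) (f : Fin n → ℚ) → sumF (λ i → k * f i) ≡ k * sumF f
sumF-*ˡ {zero}  k f = sym (*-zeroʳ k)
sumF-*ˡ {suc n} k f =
  trans (cong (k * f zero +_) (sumF-*ˡ k (λ i → f (suc i)))) (sym (*-distribˡ-+ k (f zero) _))

sumF-↑ : ∀ d (f : Fin (d ℕ.+ 1) → ℚ) → sumF f ≡ sumF (λ i → f (i ↑ˡ 1)) + f (d ↑ʳ zero)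
sumF-↑ zero    f = trans (+-identityʳ (f zero)) (sym (+-identityˡ (f zero)))
sumF-↑ (suc d) f = trans (cong (f zero +_) (sumF-↑ d (λ i → f (suc i)))) (sym (+-assoc (f zero) _ _))

_+v_ : ∀ {n} → Vec n → Vec n → Vec n
(x +v y) i = x i + y i

infixl 6 _+v_

≐-sym : ∀ {n} {u v : Vec n} → u ≐ v → v ≐ u
≐-sym u≐v i = sym (u≐v i)

·-cong : ∀ {n} {u u′ v v′ : Vec n} → u ≐ u′ → v ≐ v′ → u · v ≡ u′ · v′
·-cong u≐u′ v≐v′ = sumF-cong (λ i → cong₂ _*_ (u≐u′ i) (v≐v′ i))

·-congʳ : ∀ {n} (u : Vec n) {v v′ : Vec n} → v ≐ v′ → u · v ≡ u · v′
·-congʳ u = ·-cong {u = u} (λ _ → refl)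

·-+v : ∀ {n} (u x y : Vec n) → u · (x +v y) ≡ u · x + u · y
·-+v {n} u x y = trans (sumF-cong (λ i → *-distribˡ-+ (u i) (x i) (y i))) (sumF-+ {n} _ _)

·-*v : ∀ {n} (u : Vec n) k x → u · (k *v x) ≡ k * (u · x)
·-*v {n} u k x =
  trans (sumF-cong (λ i → solve 3 (λ u k x → u :* (k :* x) := k :* (u :* x)) refl (u i) k (x i)))
        (sumF-*ˡ {n} k _)

·-step : ∀ {n} (u p : Vec n) δ v → u · (p +v δ *v v) ≡ u · p + δ * (u · v)
·-step u p δ v = trans (·-+v u p (δ *v v)) (cong (u · p +_) (·-*v u δ v))

·-negˡ : ∀ {n} (u v : Vec n) → (λ i → - u i) · v ≡ - (u · v)
·-negˡ {n} u v =
  trans (sumF-cong (λ i → solve 2 (λ u v → (:- u) :* v := (:- con 1ℚ) :* (u :* v)) refl (u i) (v i)))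
        (trans (sumF-*ˡ {n} (- 1ℚ) _) (solve 1 (λ s → (:- con 1ℚ) :* s := :- s) refl _))

·-zeroˡ : ∀ {n} (v : Vec n) → (λ _ → 0ℚ) · v ≡ 0ℚ
·-zeroˡ {zero}  v = refl
·-zeroˡ {suc n} v = trans (cong₂ _+_ (*-zeroˡ (v zero)) (·-zeroˡ (λ i → v (suc i)))) (+-identityʳ 0ℚ)

·-split : ∀ {d} (u v : Vec (d ℕ.+ 1)) → u · v ≡ fstV u · fstV v + lastV u * lastV v
·-split {d} u v = sumF-↑ d _

fstV-ext : ∀ {d} (c : Vec d) t → fstV (ext c t) ≐ c
fstV-ext {d} c t i rewrite splitAt-↑ˡ d i 1 = refl

lastV-ext : ∀ {d} (c : Vec d) t → lastV (ext c t) ≡ t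
lastV-ext {d} c t rewrite splitAt-↑ʳ d 1 zero = refl

↑ˡ⊎last : ∀ n (j : Fin (n ℕ.+ 1)) → (∃ λ i → j ≡ i ↑ˡ 1) ⊎ j ≡ n ↑ʳ zero
↑ˡ⊎last n j with splitAt n j in eq
... | inj₁ i    = inj₁ (i , trans (sym (join-splitAt n 1 j)) (cong (join n 1) eq))
... | inj₂ zero = inj₂ (trans (sym (join-splitAt n 1 j)) (cong (join n 1) eq))

≐-ext : ∀ {d} {y : Vec (d ℕ.+ 1)} {c t} → fstV y ≐ c → lastV y ≡ t → y ≐ ext c t
≐-ext {d} {y} {c} {t} fst≐c last≡t j with ↑ˡ⊎last d j
... | inj₁ (i , refl) = trans (fst≐c i) (sym (fstV-ext c t i))
... | inj₂ refl       = trans last≡t (sym (lastV-ext c t))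

*v-ext : ∀ {d} k (c : Vec d) t → (k *v ext c t) ≐ ext (k *v c) (k * t)
*v-ext k c t = ≐-ext (λ i → cong (k *_) (fstV-ext c t i)) (cong (k *_) (lastV-ext c t))

fstV-nonzero : ∀ {d} {y : Vec (d ℕ.+ 1)} → NonZeroVec y → lastV y ≡ 0ℚ → NonZeroVec (fstV y)
fstV-nonzero {d} (j , yⱼ≢0) last≡0 with ↑ˡ⊎last d j
... | inj₁ (i , refl) = i , yⱼ≢0
... | inj₂ refl       = ⊥-elim (yⱼ≢0 last≡0)

ext-nonzero : ∀ {d} (c : Vec d) t → NonZeroVec c → NonZeroVec (ext c t)
ext-nonzero c t (i , cᵢ≢0) = i ↑ˡ 1 , ≢0-resp-≡ (sym (fstV-ext c t i)) cᵢ≢0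

ext-· : ∀ {d} (c : Vec d) t (v : Vec (d ℕ.+ 1)) → ext c t · v ≡ c · fstV v + t * lastV v
ext-· c t v =
  trans (·-split (ext c t) v)
        (cong₂ _+_ (·-cong (fstV-ext c t) (λ _ → refl)) (cong (_* lastV v) (lastV-ext c t)))

∥_∥₁ : ∀ {n} → Vec n → ℚ
∥ v ∥₁ = sumF (λ j → ∣ v j ∣)

∥∥₁-nonNeg : ∀ {n} (v : Vec n) → 0ℚ ≤ ∥ v ∥₁
∥∥₁-nonNeg {zero}  v = ≤-refl
∥∥₁-nonNeg {suc n} v =
  ≤-trans (≤-reflexive (sym (+-identityʳ 0ℚ))) (+-mono-≤ (0≤∣p∣ (v zero)) (∥∥₁-nonNeg (λ j → v (suc j))))

∣vᵢ∣≤∥v∥₁ : ∀ {n} (v : Vec n) i → ∣ v i ∣ ≤ ∥ v ∥₁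
∣vᵢ∣≤∥v∥₁ {suc n} v zero =
  ≤-trans (≤-reflexive (sym (+-identityʳ _))) (+-monoʳ-≤ ∣ v zero ∣ (∥∥₁-nonNeg (λ j → v (suc j))))
∣vᵢ∣≤∥v∥₁ {suc n} v (suc i) =
  ≤-trans (∣vᵢ∣≤∥v∥₁ (λ j → v (suc j)) i)
          (≤-trans (≤-reflexive (sym (+-identityˡ _))) (+-monoˡ-≤ _ (0≤∣p∣ (v zero))))

Polyhedron-≐ : ∀ {m n} {A : Mat m n} {b} {y z} → y ≐ z → Polyhedron A b y → Polyhedron A b z
Polyhedron-≐ {A = A} y≐z y∈P j = subst (_ ≤_) (·-congʳ (A j) y≐z) (y∈P j)

interior-mem : ∀ {n} {S : Vec n → Set} {p} → InteriorPoint S p → S p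
interior-mem {p = p} (ε , ε>0 , ball) =
  ball p (λ i → subst (_< ε) (sym (cong ∣_∣ (+-inverseʳ (p i)))) ε>0)

-- The step δ = ε / (1 + ∥v∥₁) keeps p + δ v in the sup-norm ε-ball around p.
interior-step : ∀ {n} {S : Vec n → Set} {p} → InteriorPoint S p →
                ∀ v → ∃ λ δ → δ > 0ℚ × S (p +v δ *v v)
interior-step {n} {S} {p} (ε , ε>0 , ball) v = δ , δ>0 , ball _ within-ε
  where
  N = 1ℚ + ∥ v ∥₁
  N>0 : N > 0ℚ
  N>0 = <-≤-trans (positive⁻¹ 1ℚ)
          (≤-trans (≤-reflexive (sym (+-identityʳ 1ℚ))) (+-monoʳ-≤ 1ℚ (∥∥₁-nonNeg v)))
  instance
    _ = positive ε>0
    _ = positive N>0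
    _ = pos⇒nonZero N
    _ = 1/pos⇒pos N
  δ = ε * 1/ N
  instance δ-pos = pos*pos⇒pos ε (1/ N)
  δ>0 : δ > 0ℚ
  δ>0 = positive⁻¹ δ
  within-ε : ∀ i → ∣ p i + δ * v i - p i ∣ < ε
  within-ε i = begin-strict
    ∣ p i + δ * v i - p i ∣  ≡⟨ cong ∣_∣ (solve 3 (λ p d v → (p :+ d :* v) :- p := d :* v) refl (p i) δ (v i)) ⟩
    ∣ δ * v i ∣              ≡⟨ ∣p*q∣≡∣p∣*∣q∣ δ (v i) ⟩
    ∣ δ ∣ * ∣ v i ∣          ≡⟨ cong (_* ∣ v i ∣) (0≤p⇒∣p∣≡p (<⇒≤ δ>0)) ⟩
    δ * ∣ v i ∣              ≤⟨ *-monoˡ-≤-nonNeg δ {{pos⇒nonNeg δ}} (∣vᵢ∣≤∥v∥₁ v i) ⟩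
    δ * ∥ v ∥₁               ≡⟨ cong (δ *_) (sym (+-identityˡ ∥ v ∥₁)) ⟩
    δ * (0ℚ + ∥ v ∥₁)        <⟨ *-monoʳ-<-pos δ (+-monoˡ-< ∥ v ∥₁ (positive⁻¹ 1ℚ)) ⟩
    δ * N                    ≡⟨ trans (*-assoc ε (1/ N) N) (cong (ε *_) (*-inverseˡ N)) ⟩
    ε * 1ℚ                   ≡⟨ *-identityʳ ε ⟩
    ε                        ∎
    where open ≤-Reasoning

/1-canonical : ∀ i → i / 1 ≡ mkℚ i 0 (Coprimality.sym (1-coprimeTo ℤ.∣ i ∣))
/1-canonical i = ↥p/↧p≡p (mkℚ i 0 (Coprimality.sym (1-coprimeTo ℤ.∣ i ∣)))

/1≡0⇒≡0 : ∀ i → i / 1 ≡ 0ℚ → i ≡ ℤ.+ 0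
/1≡0⇒≡0 i i/1≡0 = cong ↥_ (trans (sym (/1-canonical i)) i/1≡0)

/1-* : ∀ i j → (i ℤ.* j) / 1 ≡ (i / 1) * (j / 1)
/1-* i j = sym (cong₂ _*_ (/1-canonical i) (/1-canonical j))

/1-pos : ∀ n → (ℤ.+ suc n) / 1 > 0ℚ
/1-pos n = positive⁻¹ _ {{normalize-pos (suc n) 1}}

unit-sign : ∀ z → ℤ.∣ z ∣ ≡ 1 → IsSign (z / 1)
unit-sign (ℤ.+ suc zero) _ = inj₁ refl
unit-sign -[1+ zero ]    _ = inj₂ refl

gcdV : ∀ {n} → ZVec n → ℕ
gcdV {zero}  g = 0
gcdV {suc n} g = gcd ℤ.∣ g zero ∣ (gcdV (λ i → g (suc i)))

gcdV∣ : ∀ {n} (g : ZVec n) i → gcdV g ∣ ℤ.∣ g i ∣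
gcdV∣ {suc n} g zero    = gcd[m,n]∣m _ _
gcdV∣ {suc n} g (suc i) = ∣-trans (gcd[m,n]∣n ℤ.∣ g zero ∣ _) (gcdV∣ (λ i → g (suc i)) i)

gcdV-greatest : ∀ {n} (g : ZVec n) {k} → (∀ i → k ∣ ℤ.∣ g i ∣) → k ∣ gcdV g
gcdV-greatest {zero}  g k∣g = divides 0 refl
gcdV-greatest {suc n} g k∣g = gcd-greatest (k∣g zero) (gcdV-greatest (λ i → g (suc i)) (λ i → k∣g (suc i)))

gcdV≡0⇒≡0 : ∀ {n} (g : ZVec n) → gcdV g ≡ 0 → ∀ i → g i ≡ ℤ.+ 0
gcdV≡0⇒≡0 g gcd≡0 i = ℤₚ.∣i∣≡0⇒i≡0 (0∣⇒≡0 (subst (_∣ ℤ.∣ g i ∣) gcd≡0 (gcdV∣ g i)))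

-- With K = gcdV g and g = K c: if k divides every c i, then k * K divides gcdV g = K, so k = 1.
primitive-part : ∀ {n} (g : ZVec n) → NonZeroVec (toℚ g) →
                 ∃ λ c → CoprimeComponents c × Σ ℚ λ K → K > 0ℚ × toℚ g ≐ (K *v toℚ c)
primitive-part g (i₀ , gᵢ₀≢0) with gcdV g in gcd≡
... | zero   = ⊥-elim (gᵢ₀≢0 (cong (_/ 1) (gcdV≡0⇒≡0 g gcd≡ i₀)))
... | suc k′ = c , c-coprime , (ℤ.+ K) / 1 , /1-pos k′ , g≐Kc
  where
  K = suc k′
  K∣g : ∀ i → ℤ.+ K ℤ∣.∣ g i
  K∣g i = ℤ∣.∣ᵤ⇒∣ (subst (_∣ ℤ.∣ g i ∣) gcd≡ (gcdV∣ g i))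
  c : ZVec _
  c i = ℤ∣._∣_.quotient (K∣g i)
  g≡cK : ∀ i → g i ≡ c i ℤ.* ℤ.+ K
  g≡cK i = ℤ∣._∣_.equality (K∣g i)
  c-coprime : CoprimeComponents c
  c-coprime k k∣c = ∣1⇒≡1 (*-cancelʳ-∣ K (subst (k ℕ.* K ∣_) (trans gcd≡ (sym (ℕₚ.*-identityˡ K)))
    (gcdV-greatest g (λ i → subst (k ℕ.* K ∣_)
      (trans (sym (ℤₚ.∣i*j∣≡∣i∣*∣j∣ (c i) (ℤ.+ K))) (cong ℤ.∣_∣ (sym (g≡cK i))))
      (*-monoˡ-∣ K (k∣c i))))))
  g≐Kc : toℚ g ≐ (((ℤ.+ K) / 1) *v toℚ c)
  g≐Kc i = trans (cong (_/ 1) (trans (g≡cK i) (ℤₚ.*-comm (c i) (ℤ.+ K)))) (/1-* (ℤ.+ K) (c i))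

coprime-init : ∀ {d} (g : ZVec (d ℕ.+ 1)) → CoprimeComponents g →
               toℚ g (d ↑ʳ zero) ≡ 0ℚ → CoprimeComponents (λ i → g (i ↑ˡ 1))
coprime-init {d} g g-coprime last≡0 k k∣init = g-coprime k k∣g
  where
  k∣g : ∀ j → k ∣ ℤ.∣ g j ∣
  k∣g j with ↑ˡ⊎last d j
  ... | inj₁ (i , refl) = k∣init i
  ... | inj₂ refl       = subst (k ∣_) (cong ℤ.∣_∣ (sym (/1≡0⇒≡0 (g (d ↑ʳ zero)) last≡0))) (divides 0 refl)

coprime-last-sign : ∀ {d} (g : ZVec (d ℕ.+ 1)) → CoprimeComponents g →
                    (∀ i → toℚ g (i ↑ˡ 1) ≡ 0ℚ) → IsSign (toℚ g (d ↑ʳ zero))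
coprime-last-sign {d} g g-coprime init≡0 = unit-sign (g (d ↑ʳ zero)) (g-coprime _ last∣g)
  where
  last∣g : ∀ j → ℤ.∣ g (d ↑ʳ zero) ∣ ∣ ℤ.∣ g j ∣
  last∣g j with ↑ˡ⊎last d j
  ... | inj₁ (i , refl) = subst (_ ∣_) (cong ℤ.∣_∣ (sym (/1≡0⇒≡0 (g (i ↑ˡ 1)) (init≡0 i)))) (divides 0 refl)
  ... | inj₂ refl       = ∣-refl

Minimal : ∀ {m n} → Mat m n → Vec n → Set
Minimal M y = ∀ x → NonZeroVec x → Support (M ⊛ x) ⊆ Support (M ⊛ y) → Support (M ⊛ y) ⊆ Support (M ⊛ x)

Minimal-⊆ : ∀ {m n} (M : Mat m n) {y y′} →
            Support (M ⊛ y′) ⊆ Support (M ⊛ y) → Minimal M y → Minimal M y′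
Minimal-⊆ M y′⊆y y-minimal x x≢0 x⊆y′ i = y-minimal x x≢0 (λ j → y′⊆y j ∘′ x⊆y′ j) i ∘′ y′⊆y i

Support-≐ : ∀ {m n} (M : Mat m n) {y y′} → y ≐ y′ → Support (M ⊛ y) ⊆ Support (M ⊛ y′)
Support-≐ M y≐y′ i = ≢0-resp-≡ (·-congʳ (M i) y≐y′)

Support-*v⁻ : ∀ {m n} (M : Mat m n) k y → Support (M ⊛ (k *v y)) ⊆ Support (M ⊛ y)
Support-*v⁻ M k y i ky≢0 y≡0 = ky≢0 (trans (·-*v (M i) k y) (trans (cong (k *_) y≡0) (*-zeroʳ k)))

Support-*v : ∀ {m n} (M : Mat m n) {k} → ¬ k ≡ 0ℚ → ∀ y → Support (M ⊛ y) ⊆ Support (M ⊛ (k *v y))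
Support-*v M {k} k≢0 y i y≢0 = ≢0-resp-≡ (sym (·-*v (M i) k y)) (*-≢0 k≢0 y≢0)

module MinimalPullback {m n m′ n′} {A : Mat m n} {W : Mat m′ n′}
  (L : Vec n → Vec n′) (ρ : Fin m → Fin m′)
  (L-nonzero : ∀ x → NonZeroVec x → NonZeroVec (L x))
  (ρ-preserves : ∀ x i → Support (A ⊛ x) i → Support (W ⊛ L x) (ρ i))
  (ρ-reflects : ∀ x i → Support (W ⊛ L x) (ρ i) → Support (A ⊛ x) i)
  (ρ-covers : ∀ x r → Support (W ⊛ L x) r → ∃ λ i → r ≡ ρ i)
  where

  Minimal-pullback : ∀ c → Minimal W (L c) → Minimal A c
  Minimal-pullback c Lc-minimal x x≢0 x⊆c i cᵢ≢0 =
    ρ-reflects x i (Lc-minimal (L x) (L-nonzero x x≢0) Lx⊆Lc (ρ i) (ρ-preserves c i cᵢ≢0))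
    where
    Lx⊆Lc : Support (W ⊛ L x) ⊆ Support (W ⊛ L c)
    Lx⊆Lc r Lxᵣ≢0 with ρ-covers x r Lxᵣ≢0
    ... | i , refl = ρ-preserves c i (x⊆c i (ρ-reflects x i Lxᵣ≢0))

module WedgeGeometry {m d} (A : Mat m d) (b : Vec m) (f : Fin m) (h : Vec d) (η β : ℚ)
  {p : Vec d} (p-interior : InteriorPoint (Polyhedron A b) p)
  {z₀ : Vec d} (z₀-others : ∀ j → ¬ j ≡ f → (A ⊛ z₀) j ≥ b j) (z₀-violates : (A ⊛ z₀) f < b f)
  (P⊆H≤ : ∀ z → Polyhedron A b z → h · z ≤ β)
  (P∩H⊆F : ∀ z → Polyhedron A b z → h · z ≡ β → FacetPt A b f z)
  (F⊆H : ∀ z → FacetPt A b f z → h · z ≡ β)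
  {w : Vec (d ℕ.+ 1)} (w-interior : InteriorPoint (Cylinder A b) w) (w∈H : OnH h η β w)
  where

  a : Vec d
  a = A f

  p∈P : Polyhedron A b p
  p∈P = interior-mem p-interior

  D : ℚ
  D = a · p - a · z₀

  D>0 : D > 0ℚ
  D>0 = p<q⇒0<q-p (<-≤-trans z₀-violates (p∈P f))

  instance
    _ = positive D>0
    _ = pos⇒nonZero D
    _ = 1/pos⇒pos D

  -- Convex weights with λ₁ (a · p) + λ₂ (a · z₀) = b f.
  λ₁ λ₂ : ℚ
  λ₁ = (b f - a · z₀) * 1/ D
  λ₂ = (a · p - b f) * 1/ D

  λ₁>0 : λ₁ > 0ℚ
  λ₁>0 = positive⁻¹ λ₁ {{pos*pos⇒pos (b f - a · z₀) {{positive (p<q⇒0<q-p z₀-violates)}} (1/ D)}}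

  λ₂≥0 : λ₂ ≥ 0ℚ
  λ₂≥0 = nonNegative⁻¹ λ₂
    {{nonNeg*nonNeg⇒nonNeg (a · p - b f) {{nonNegative (p≤q⇒0≤q-p (p∈P f))}} (1/ D) {{pos⇒nonNeg (1/ D)}}}}

  λ₁+λ₂≡1 : λ₁ + λ₂ ≡ 1ℚ
  λ₁+λ₂≡1 = trans (solve 4 (λ B Z X i → (B :- Z) :* i :+ (X :- B) :* i := (X :- Z) :* i) refl
                           (b f) (a · z₀) (a · p) (1/ D))
                  (*-inverseʳ D)

  toward-z₀ : Vec d → Vec d
  toward-z₀ y = λ₁ *v y +v λ₂ *v z₀

  ·-toward-z₀ : ∀ u y → u · toward-z₀ y ≡ λ₁ * (u · y) + λ₂ * (u · z₀)
  ·-toward-z₀ u y = trans (·-+v u (λ₁ *v y) (λ₂ *v z₀)) (cong₂ _+_ (·-*v u λ₁ y) (·-*v u λ₂ z₀))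

  toward-z₀-facet : ∀ y → Polyhedron A b y → a · y ≡ a · p → FacetPt A b f (toward-z₀ y)
  toward-z₀-facet y y∈P a·y≡a·p = toward-z₀∈P , on-facet
    where
    on-facet : a · toward-z₀ y ≡ b f
    on-facet = begin
      a · toward-z₀ y                   ≡⟨ ·-toward-z₀ a y ⟩
      λ₁ * (a · y) + λ₂ * (a · z₀)      ≡⟨ cong (λ s → λ₁ * s + λ₂ * (a · z₀)) a·y≡a·p ⟩
      λ₁ * (a · p) + λ₂ * (a · z₀)      ≡⟨ solve 4 (λ B Z X i → (B :- Z) :* i :* X :+ (X :- B) :* i :* Z
                                                            := B :* ((X :- Z) :* i)) refl (b f) (a · z₀) (a · p) (1/ D) ⟩
      b f * (D * 1/ D)                  ≡⟨ cong (b f *_) (*-inverseʳ D) ⟩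
      b f * 1ℚ                          ≡⟨ *-identityʳ (b f) ⟩
      b f                               ∎
      where open ≡-Reasoning
    toward-z₀∈P : Polyhedron A b (toward-z₀ y)
    toward-z₀∈P j with j Fin.≟ f
    ... | yes refl = ≤-reflexive (sym on-facet)
    ... | no  j≢f  = begin
      b j                               ≡⟨ sym (trans (cong (_* b j) λ₁+λ₂≡1) (*-identityˡ (b j))) ⟩
      (λ₁ + λ₂) * b j                   ≡⟨ *-distribʳ-+ (b j) λ₁ λ₂ ⟩
      λ₁ * b j + λ₂ * b j               ≤⟨ +-mono-≤ (*-monoˡ-≤-nonNeg λ₁ {{pos⇒nonNeg λ₁ {{positive λ₁>0}}}} (y∈P j))
                                                    (*-monoˡ-≤-nonNeg λ₂ {{nonNegative λ₂≥0}} (z₀-others j j≢f)) ⟩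
      λ₁ * (A j · y) + λ₂ * (A j · z₀)  ≡⟨ sym (·-toward-z₀ (A j) y) ⟩
      A j · toward-z₀ y                 ∎
      where open ≤-Reasoning

  h-toward-z₀ : ∀ y → Polyhedron A b y → a · y ≡ a · p → λ₁ * (h · y) + λ₂ * (h · z₀) ≡ β
  h-toward-z₀ y y∈P a·y≡a·p = trans (sym (·-toward-z₀ h y)) (F⊆H _ (toward-z₀-facet y y∈P a·y≡a·p))

  -- Moving p inside P along ker a keeps toward-z₀ on F ⊆ H, so h cannot change.
  ker-a⊆ker-h : ∀ v → a · v ≡ 0ℚ → h · v ≡ 0ℚ
  ker-a⊆ker-h v a·v≡0 = from-step (interior-step p-interior v)
    where
    from-step : (∃ λ δ → δ > 0ℚ × Polyhedron A b (p +v δ *v v)) → h · v ≡ 0ℚ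
    from-step (δ , δ>0 , y∈P) = *-cancelˡ-≡0 (*-≢0 (p>0⇒p≢0 λ₁>0) (p>0⇒p≢0 δ>0)) (begin
      λ₁ * δ * (h · v)                             ≡⟨ solve 6 (λ l₁ δ hv hp l₂ hz → l₁ :* δ :* hv
                                                          := (l₁ :* (hp :+ δ :* hv) :+ l₂ :* hz) :- (l₁ :* hp :+ l₂ :* hz))
                                                        refl λ₁ δ (h · v) (h · p) λ₂ (h · z₀) ⟩
      (λ₁ * (h · p + δ * (h · v)) + λ₂ * (h · z₀))
        - (λ₁ * (h · p) + λ₂ * (h · z₀))           ≡⟨ cong₂ _-_ (trans (cong (λ s → λ₁ * s + λ₂ * (h · z₀))
                                                                               (sym (·-step h p δ v)))
                                                                         (h-toward-z₀ _ y∈P a·y≡a·p))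
                                                               (h-toward-z₀ p p∈P refl) ⟩
      β - β                                        ≡⟨ +-inverseʳ β ⟩
      0ℚ                                           ∎)
      where
      open ≡-Reasoning
      a·y≡a·p : a · (p +v δ *v v) ≡ a · p
      a·y≡a·p = trans (·-step a p δ v) (trans (cong (λ s → a · p + δ * s) a·v≡0)
                                              (trans (cong (a · p +_) (*-zeroʳ δ)) (+-identityʳ (a · p))))

  u : Vec d
  u = p +v (- 1ℚ) *v z₀

  a·u≡D : a · u ≡ D
  a·u≡D = trans (·-step a p (- 1ℚ) z₀)
                (solve 2 (λ x z → x :+ (:- con 1ℚ) :* z := x :- z) refl (a · p) (a · z₀))

  -- D x - (a · x) u lies in ker a, hence in ker h.
  h-proportional-to-a : ∀ x → D * (h · x) ≡ (a · x) * (h · u)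
  h-proportional-to-a x = begin
    D * (h · x)
      ≡⟨ solve 4 (λ D hx ax hu → D :* hx := (D :* hx :+ (:- ax) :* hu) :+ ax :* hu) refl D (h · x) (a · x) (h · u) ⟩
    (D * (h · x) + - (a · x) * (h · u)) + (a · x) * (h · u)
      ≡⟨ cong (_+ (a · x) * (h · u)) (trans (sym (·-v h)) (ker-a⊆ker-h v a·v≡0)) ⟩
    0ℚ + (a · x) * (h · u)
      ≡⟨ +-identityˡ _ ⟩
    (a · x) * (h · u)
      ∎
    where
    open ≡-Reasoning
    v = D *v x +v (- (a · x)) *v u
    ·-v : ∀ r → r · v ≡ D * (r · x) + - (a · x) * (r · u)
    ·-v r = trans (·-+v r (D *v x) _) (cong₂ _+_ (·-*v r D x) (·-*v r (- (a · x)) u))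
    a·v≡0 : a · v ≡ 0ℚ
    a·v≡0 = trans (·-v a) (trans (cong (λ s → D * (a · x) + - (a · x) * s) a·u≡D)
                                 (solve 2 (λ D ax → D :* ax :+ (:- ax) :* D := con 0ℚ) refl D (a · x)))

  -- Otherwise h = 0 and β = 0, so all of P would lie in H and hence in F;
  -- but P reaches beyond F in direction u.
  h·u≢0 : ¬ h · u ≡ 0ℚ
  h·u≢0 h·u≡0 = from-step (interior-step p-interior u)
    where
    h≡0 : ∀ x → h · x ≡ 0ℚ
    h≡0 x = *-cancelˡ-≡0 (p>0⇒p≢0 D>0)
              (trans (h-proportional-to-a x) (trans (cong ((a · x) *_) h·u≡0) (*-zeroʳ (a · x))))
    β≡0 : β ≡ 0ℚ
    β≡0 = trans (sym (h-toward-z₀ p p∈P refl))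
                (trans (cong₂ (λ s r → λ₁ * s + λ₂ * r) (h≡0 p) (h≡0 z₀))
                       (solve 2 (λ x y → x :* con 0ℚ :+ y :* con 0ℚ := con 0ℚ) refl λ₁ λ₂))
    from-step : (∃ λ δ → δ > 0ℚ × Polyhedron A b (p +v δ *v u)) → ⊥
    from-step (δ , δ>0 , y∈P) = <-irrefl (sym a·y≡b) (begin-strict
      b f                 ≤⟨ p∈P f ⟩
      a · p               ≡⟨ sym (+-identityʳ (a · p)) ⟩
      a · p + 0ℚ          <⟨ +-monoʳ-< (a · p) (positive⁻¹ (δ * D) {{pos*pos⇒pos δ {{positive δ>0}} D}}) ⟩
      a · p + δ * D       ≡⟨ sym (trans (·-step a p δ u) (cong (λ s → a · p + δ * s) a·u≡D)) ⟩
      a · (p +v δ *v u)   ∎)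
      where
      open ≤-Reasoning
      a·y≡b : a · (p +v δ *v u) ≡ b f
      a·y≡b = proj₂ (P∩H⊆F _ y∈P (trans (h≡0 _) (sym β≡0)))

  ker-h⊆ker-a : ∀ x → h · x ≡ 0ℚ → a · x ≡ 0ℚ
  ker-h⊆ker-a x h·x≡0 = *-cancelˡ-≡0 h·u≢0 (begin
    h · u * (a · x)     ≡⟨ *-comm (h · u) (a · x) ⟩
    a · x * (h · u)     ≡⟨ sym (h-proportional-to-a x) ⟩
    D * (h · x)         ≡⟨ cong (D *_) h·x≡0 ⟩
    D * 0ℚ              ≡⟨ *-zeroʳ D ⟩
    0ℚ                  ∎)
    where open ≡-Reasoning

  -- If η = 0, the interior point fstV w of P lies on H, so P ⊆ H≤ forces h · σ ≤ 0 for every σ.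
  η≢0 : ¬ η ≡ 0ℚ
  η≢0 η≡0 = h·u≢0 (≤-antisym (h-nonpositive u) h·u≥0)
    where
    h·w≡β : h · fstV w ≡ β
    h·w≡β = trans (sym (trans (cong (λ e → h · fstV w + e * lastV w) η≡0)
                              (trans (cong (h · fstV w +_) (*-zeroˡ (lastV w))) (+-identityʳ _))))
                  w∈H
    h-nonpositive : ∀ σ → h · σ ≤ 0ℚ
    h-nonpositive σ = from-step (interior-step w-interior (ext σ 0ℚ))
      where
      from-step : (∃ λ δ → δ > 0ℚ × Cylinder A b (w +v δ *v ext σ 0ℚ)) → h · σ ≤ 0ℚ
      from-step (δ , δ>0 , shifted-w∈cylinder) = *-cancelˡ-≤-pos δ {{positive δ>0}} (begin
        δ * (h · σ)                  ≡⟨ solve 2 (λ b s → s := (b :+ s) :- b) refl β (δ * (h · σ)) ⟩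
        β + δ * (h · σ) - β          ≡⟨ cong (λ s → s + δ * (h · σ) - β) (sym h·w≡β) ⟩
        h · fstV w + δ * (h · σ) - β ≡⟨ cong (_- β) (sym (·-step h (fstV w) δ σ)) ⟩
        h · (fstV w +v δ *v σ) - β   ≤⟨ +-monoˡ-≤ (- β) (P⊆H≤ _ shifted∈P) ⟩
        β - β                        ≡⟨ +-inverseʳ β ⟩
        0ℚ                           ≡⟨ sym (*-zeroʳ δ) ⟩
        δ * 0ℚ                       ∎)
        where
        open ≤-Reasoning
        shifted∈P : Polyhedron A b (fstV w +v δ *v σ)
        shifted∈P = Polyhedron-≐ {A = A} (λ i → cong (λ s → fstV w i + δ * s) (fstV-ext σ 0ℚ i))
                                  (proj₁ shifted-w∈cylinder)
    h·u≥0 : 0ℚ ≤ h · u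
    h·u≥0 = subst (0ℚ ≤_) (solve 1 (λ x → :- ((:- con 1ℚ) :* x) := x) refl (h · u))
              (neg-antimono-≤ (subst (_≤ 0ℚ) (·-*v h (- 1ℚ) u) (h-nonpositive ((- 1ℚ) *v u))))

module WedgeRows {m d} (A : Mat m d) (f : Fin m) (h : Vec d) (η : ℚ) where

  W : Mat (m ℕ.+ 1) (d ℕ.+ 1)
  W = wedgeMat A f h η

  cut : Vec (d ℕ.+ 1) → ℚ
  cut y = h · fstV y + η * lastV y

  cut-ext : ∀ c t → cut (ext c t) ≡ h · c + η * t
  cut-ext c t = cong₂ (λ s r → s + η * r) (·-congʳ h (fstV-ext c t)) (lastV-ext c t)

  W-other : ∀ i → ¬ i ≡ f → W (i ↑ˡ 1) ≐ ext (A i) 0ℚ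
  W-other i i≢f k rewrite splitAt-↑ˡ m i 1 with i Fin.≟ f
  ... | yes i≡f = ⊥-elim (i≢f i≡f)
  ... | no  _   = refl

  W-facet : W (f ↑ˡ 1) ≐ ext (λ j → - h j) (- η)
  W-facet k rewrite splitAt-↑ˡ m f 1 with f Fin.≟ f
  ... | yes _   = refl
  ... | no  f≢f = ⊥-elim (f≢f refl)

  W-last : W (m ↑ʳ zero) ≐ ext (λ _ → 0ℚ) 1ℚ
  W-last k rewrite splitAt-↑ʳ m 1 zero = refl

  row-other : ∀ i → ¬ i ≡ f → ∀ y → (W ⊛ y) (i ↑ˡ 1) ≡ A i · fstV y
  row-other i i≢f y = begin
    W (i ↑ˡ 1) · y                   ≡⟨ ·-cong (W-other i i≢f) (λ _ → refl) ⟩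
    ext (A i) 0ℚ · y                 ≡⟨ ext-· (A i) 0ℚ y ⟩
    A i · fstV y + 0ℚ * lastV y      ≡⟨ cong (A i · fstV y +_) (*-zeroˡ (lastV y)) ⟩
    A i · fstV y + 0ℚ                ≡⟨ +-identityʳ _ ⟩
    A i · fstV y                     ∎
    where open ≡-Reasoning

  row-facet : ∀ y → (W ⊛ y) (f ↑ˡ 1) ≡ - cut y
  row-facet y = begin
    W (f ↑ˡ 1) · y                            ≡⟨ ·-cong W-facet (λ _ → refl) ⟩
    ext (λ j → - h j) (- η) · y               ≡⟨ ext-· (λ j → - h j) (- η) y ⟩
    (λ j → - h j) · fstV y + - η * lastV y    ≡⟨ cong (_+ - η * lastV y) (·-negˡ h (fstV y)) ⟩
    - (h · fstV y) + - η * lastV y            ≡⟨ solve 3 (λ s e t → :- s :+ (:- e) :* t := :- (s :+ e :* t))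
                                                        refl (h · fstV y) η (lastV y) ⟩
    - cut y                                   ∎
    where open ≡-Reasoning

  row-last : ∀ y → (W ⊛ y) (m ↑ʳ zero) ≡ lastV y
  row-last y = begin
    W (m ↑ʳ zero) · y                         ≡⟨ ·-cong W-last (λ _ → refl) ⟩
    ext (λ _ → 0ℚ) 1ℚ · y                     ≡⟨ ext-· (λ _ → 0ℚ) 1ℚ y ⟩
    (λ _ → 0ℚ) · fstV y + 1ℚ * lastV y        ≡⟨ cong₂ _+_ (·-zeroˡ (fstV y)) (*-identityˡ (lastV y)) ⟩
    0ℚ + lastV y                              ≡⟨ +-identityˡ (lastV y) ⟩
    lastV y                                   ∎
    where open ≡-Reasoning

  row-other-ext : ∀ i → ¬ i ≡ f → ∀ c t → (W ⊛ ext c t) (i ↑ˡ 1) ≡ A i · c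
  row-other-ext i i≢f c t = trans (row-other i i≢f (ext c t)) (·-congʳ (A i) (fstV-ext c t))

  row-last-ext : ∀ c t → (W ⊛ ext c t) (m ↑ʳ zero) ≡ t
  row-last-ext c t = trans (row-last (ext c t)) (lastV-ext c t)

  φ-multiple : ∀ y {K} (K≢0 : ¬ K ≡ 0ℚ) {c₀ : Vec d} → cut y ≡ 0ℚ → fstV y ≐ (K *v c₀) →
               ∃ λ w → IsPhi h η (1ℚ *v c₀) w × y ≐ (K *v w)
  φ-multiple y {K} K≢0 {c₀} cut≡0 c≐Kc₀ = ext (1ℚ *v c₀) t′ , (t′ , φ-equation , λ _ → refl) , y≐Kw
    where
    instance _ = ≢-nonZero K≢0
    c = fstV y
    t = lastV y
    t′ = t * 1/ K
    φ-equation : h · (1ℚ *v c₀) + η * t′ ≡ 0ℚ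
    φ-equation = *-cancelˡ-≡0 K≢0 (begin
      K * (h · (1ℚ *v c₀) + η * t′)          ≡⟨ cong (λ s → K * (s + η * t′)) (·-*v h 1ℚ c₀) ⟩
      K * (1ℚ * (h · c₀) + η * (t * 1/ K))   ≡⟨ solve 5 (λ K s e t k → K :* (con 1ℚ :* s :+ e :* (t :* k))
                                                          := K :* s :+ e :* t :* (K :* k))
                                                        refl K (h · c₀) η t (1/ K) ⟩
      K * (h · c₀) + η * t * (K * 1/ K)      ≡⟨ cong₂ (λ s k → s + η * t * k)
                                                   (sym (trans (·-congʳ h c≐Kc₀) (·-*v h K c₀))) (*-inverseʳ K) ⟩
      h · c + η * t * 1ℚ                     ≡⟨ cong (h · c +_) (*-identityʳ (η * t)) ⟩
      cut y                                  ≡⟨ cut≡0 ⟩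
      0ℚ                                     ∎)
      where open ≡-Reasoning
    t≡Kt′ : t ≡ K * t′
    t≡Kt′ = sym (trans (solve 3 (λ K t k → K :* (t :* k) := t :* (K :* k)) refl K t (1/ K))
                       (trans (cong (t *_) (*-inverseʳ K)) (*-identityʳ t)))
    y≐Kw : y ≐ (K *v ext (1ℚ *v c₀) t′)
    y≐Kw j = trans (≐-ext (λ i → trans (c≐Kc₀ i) (cong (K *_) (sym (*-identityˡ (c₀ i))))) t≡Kt′ j)
                   (≐-sym (*v-ext K (1ℚ *v c₀) t′) j)

module WedgeCircuits {m d} (A : Mat m d) (f : Fin m) (h : Vec d) (η : ℚ)
  (η≢0 : ¬ η ≡ 0ℚ)
  (ker-h⊆ker-a : ∀ x → h · x ≡ 0ℚ → A f · x ≡ 0ℚ)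
  (ker-a⊆ker-h : ∀ x → A f · x ≡ 0ℚ → h · x ≡ 0ℚ)
  where

  open WedgeRows A f h η

  a≢0⇒h≢0 : ∀ x → ¬ A f · x ≡ 0ℚ → ¬ h · x ≡ 0ℚ
  a≢0⇒h≢0 x a≢0 = a≢0 ∘′ ker-h⊆ker-a x

  h≢0⇒a≢0 : ∀ x → ¬ h · x ≡ 0ℚ → ¬ A f · x ≡ 0ℚ
  h≢0⇒a≢0 x h≢0 = h≢0 ∘′ ker-a⊆ker-h x

  horizontal : Vec d → Vec (d ℕ.+ 1)
  horizontal x = ext x 0ℚ

  cut-horizontal : ∀ x → cut (horizontal x) ≡ h · x
  cut-horizontal x = trans (cut-ext x 0ℚ) (trans (cong (h · x +_) (*-zeroʳ η)) (+-identityʳ (h · x)))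

  Minimal-horizontal : ∀ c → Minimal W (horizontal c) → Minimal A c
  Minimal-horizontal = Minimal-pullback
    where
    preserves : ∀ x i → Support (A ⊛ x) i → Support (W ⊛ horizontal x) (i ↑ˡ 1)
    preserves x i Axᵢ≢0 with i Fin.≟ f
    ... | yes refl = ≢0-resp-≡ (sym (trans (row-facet _) (cong -_ (cut-horizontal x))))
                       (-≢0 (a≢0⇒h≢0 x Axᵢ≢0))
    ... | no  i≢f  = ≢0-resp-≡ (sym (row-other-ext i i≢f x 0ℚ)) Axᵢ≢0
    reflects : ∀ x i → Support (W ⊛ horizontal x) (i ↑ˡ 1) → Support (A ⊛ x) i
    reflects x i Wxᵢ≢0 with i Fin.≟ f
    ... | yes refl =
      h≢0⇒a≢0 x (-≢0⁻ (≢0-resp-≡ (trans (row-facet _) (cong -_ (cut-horizontal x))) Wxᵢ≢0))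
    ... | no  i≢f  = ≢0-resp-≡ (row-other-ext i i≢f x 0ℚ) Wxᵢ≢0
    covers : ∀ x r → Support (W ⊛ horizontal x) r → ∃ λ i → r ≡ i ↑ˡ 1
    covers x r Wxᵣ≢0 with ↑ˡ⊎last m r
    ... | inj₁ i,r≡i   = i,r≡i
    ... | inj₂ refl    = ⊥-elim (Wxᵣ≢0 (row-last-ext x 0ℚ))
    open MinimalPullback {A = A} {W = W} horizontal (_↑ˡ 1) (λ x → ext-nonzero x 0ℚ)
                         preserves reflects covers

  -- η · φ((x, 0)): the lift of x parallel to H, scaled so that no division by η occurs.
  parallel : Vec d → Vec (d ℕ.+ 1)
  parallel x = ext (η *v x) (- (h · x))

  cut-parallel : ∀ x → cut (parallel x) ≡ 0ℚ
  cut-parallel x = begin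
    cut (parallel x)                   ≡⟨ cut-ext (η *v x) (- (h · x)) ⟩
    h · (η *v x) + η * - (h · x)       ≡⟨ cong (_+ η * - (h · x)) (·-*v h η x) ⟩
    η * (h · x) + η * - (h · x)        ≡⟨ solve 2 (λ e s → e :* s :+ e :* (:- s) := con 0ℚ) refl η (h · x) ⟩
    0ℚ                                 ∎
    where open ≡-Reasoning

  row-other-parallel : ∀ i → ¬ i ≡ f → ∀ x → (W ⊛ parallel x) (i ↑ˡ 1) ≡ η * (A i · x)
  row-other-parallel i i≢f x = trans (row-other-ext i i≢f (η *v x) _) (·-*v (A i) η x)

  row-facet-parallel : ∀ x → (W ⊛ parallel x) (f ↑ˡ 1) ≡ 0ℚ
  row-facet-parallel x = trans (row-facet (parallel x)) (cong -_ (cut-parallel x))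

  parallel-other-reflects : ∀ i → ¬ i ≡ f → ∀ x →
                            Support (W ⊛ parallel x) (i ↑ˡ 1) → Support (A ⊛ x) i
  parallel-other-reflects i i≢f x Wxᵢ≢0 Axᵢ≡0 =
    Wxᵢ≢0 (trans (row-other-parallel i i≢f x) (trans (cong (η *_) Axᵢ≡0) (*-zeroʳ η)))

  parallel-nonzero : ∀ x → NonZeroVec x → NonZeroVec (parallel x)
  parallel-nonzero x (i , xᵢ≢0) = ext-nonzero (η *v x) _ (i , *-≢0 η≢0 xᵢ≢0)

  parallel-row : Fin m → Fin (m ℕ.+ 1)
  parallel-row i with i Fin.≟ f
  ... | yes _ = m ↑ʳ zero
  ... | no  _ = i ↑ˡ 1

  parallel-row-facet : parallel-row f ≡ m ↑ʳ zero
  parallel-row-facet with f Fin.≟ f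
  ... | yes _   = refl
  ... | no  f≢f = ⊥-elim (f≢f refl)

  parallel-row-other : ∀ {i} → ¬ i ≡ f → parallel-row i ≡ i ↑ˡ 1
  parallel-row-other {i} i≢f with i Fin.≟ f
  ... | yes i≡f = ⊥-elim (i≢f i≡f)
  ... | no  _   = refl

  Minimal-parallel : ∀ c → Minimal W (parallel c) → Minimal A c
  Minimal-parallel = Minimal-pullback
    where
    preserves : ∀ x i → Support (A ⊛ x) i → Support (W ⊛ parallel x) (parallel-row i)
    preserves x i Axᵢ≢0 with i Fin.≟ f
    ... | yes refl = ≢0-resp-≡ (sym (row-last-ext (η *v x) _)) (-≢0 (a≢0⇒h≢0 x Axᵢ≢0))
    ... | no  i≢f  = ≢0-resp-≡ (sym (row-other-parallel i i≢f x)) (*-≢0 η≢0 Axᵢ≢0)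
    reflects : ∀ x i → Support (W ⊛ parallel x) (parallel-row i) → Support (A ⊛ x) i
    reflects x i Wxᵢ≢0 with i Fin.≟ f
    ... | yes refl = h≢0⇒a≢0 x (-≢0⁻ (≢0-resp-≡ (row-last-ext (η *v x) _) Wxᵢ≢0))
    ... | no  i≢f  = parallel-other-reflects i i≢f x Wxᵢ≢0
    covers : ∀ x r → Support (W ⊛ parallel x) r → ∃ λ i → r ≡ parallel-row i
    covers x r Wxᵣ≢0 with ↑ˡ⊎last m r
    ... | inj₂ refl         = f , sym parallel-row-facet
    ... | inj₁ (i , refl) with i Fin.≟ f
    ...   | yes refl = ⊥-elim (Wxᵣ≢0 (row-facet-parallel x))
    ...   | no  i≢f  = i , sym (parallel-row-other i≢f)
    open MinimalPullback {A = A} {W = W} parallel parallel-row parallel-nonzero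
                         preserves reflects covers

  -- Otherwise parallel (fstV y) would have strictly smaller support in W than y.
  cut-vanishes : ∀ y → Minimal W y → ¬ lastV y ≡ 0ℚ → NonZeroVec (fstV y) → cut y ≡ 0ℚ
  cut-vanishes y y-minimal t≢0 c≢0 with cut y ≟ 0ℚ
  ... | yes cut≡0 = cut≡0
  ... | no  cut≢0 =
    ⊥-elim (y-minimal (parallel c) (parallel-nonzero c c≢0) P⊆y (f ↑ˡ 1) y-facet≢0
                      (row-facet-parallel c))
    where
    c = fstV y
    y-facet≢0 : Support (W ⊛ y) (f ↑ˡ 1)
    y-facet≢0 = ≢0-resp-≡ (sym (row-facet y)) (-≢0 cut≢0)
    P⊆y : Support (W ⊛ parallel c) ⊆ Support (W ⊛ y)
    P⊆y r Pᵣ≢0 with ↑ˡ⊎last m r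
    ... | inj₂ refl = ≢0-resp-≡ (sym (row-last y)) t≢0
    ... | inj₁ (i , refl) with i Fin.≟ f
    ...   | yes refl = ⊥-elim (Pᵣ≢0 (row-facet-parallel c))
    ...   | no  i≢f  = ≢0-resp-≡ (sym (row-other i i≢f y)) (parallel-other-reflects i i≢f c Pᵣ≢0)

  η*v≐parallel : ∀ y → cut y ≡ 0ℚ → (η *v y) ≐ parallel (fstV y)
  η*v≐parallel y cut≡0 = ≐-ext (λ _ → refl) (sym (+≡0⇒-≡ cut≡0))

  VerticalForm : ZVec (d ℕ.+ 1) → Set
  VerticalForm g = ∃ λ σ → IsSign σ × toℚ g ≐ ext (λ _ → 0ℚ) σ

  HorizontalForm : ZVec (d ℕ.+ 1) → Set
  HorizontalForm g = ∃ λ c → IsCircuit A c × ∃ λ σ → IsSign σ × toℚ g ≐ ext (σ *v toℚ c) 0ℚ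

  ParallelForm : ZVec (d ℕ.+ 1) → Set
  ParallelForm g = ∃ λ c → IsCircuit A c × ∃ λ σ → IsSign σ ×
                   Σ ℚ λ λq → λq > 0ℚ × ∃ λ w → IsPhi h η (σ *v toℚ c) w × toℚ g ≐ (λq *v w)

  horizontal-case : ∀ g → IsCircuit W g → lastV (toℚ g) ≡ 0ℚ → HorizontalForm g
  horizontal-case g (g≢0 , g-coprime , g-minimal) t≡0 =
    c , (fstV-nonzero g≢0 t≡0 , coprime-init g g-coprime t≡0 , c-minimal) , 1ℚ , inj₁ refl ,
    ≐-ext (λ i → sym (*-identityˡ _)) t≡0
    where
    c : ZVec d
    c i = g (i ↑ˡ 1)
    g≐horizontal : toℚ g ≐ horizontal (toℚ c)
    g≐horizontal = ≐-ext (λ _ → refl) t≡0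
    c-minimal : Minimal A (toℚ c)
    c-minimal = Minimal-horizontal (toℚ c) (Minimal-⊆ W (Support-≐ W (≐-sym g≐horizontal)) g-minimal)

  parallel-case : ∀ g → IsCircuit W g → ¬ lastV (toℚ g) ≡ 0ℚ → NonZeroVec (fstV (toℚ g)) →
                  ParallelForm g
  parallel-case g (_ , _ , g-minimal) t≢0 c≢0 with primitive-part (λ i → g (i ↑ˡ 1)) c≢0
  ... | c₀ , c₀-coprime , K , K>0 , c≐Kc₀ =
    c₀ , (c₀≢0 , c₀-coprime , c₀-minimal) , 1ℚ , inj₁ refl , K , K>0 , φ-multiple y K≢0 cut≡0 c≐Kc₀
    where
    y = toℚ g
    c = fstV y
    K≢0 = p>0⇒p≢0 K>0
    cut≡0 : cut y ≡ 0ℚ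
    cut≡0 = cut-vanishes y g-minimal t≢0 c≢0
    c-minimal : Minimal A c
    c-minimal = Minimal-parallel c (Minimal-⊆ W parallel⊆y g-minimal)
      where
      parallel⊆y : Support (W ⊛ parallel c) ⊆ Support (W ⊛ y)
      parallel⊆y r = Support-*v⁻ W η y r ∘′ Support-≐ W (≐-sym (η*v≐parallel y cut≡0)) r
    c₀-minimal : Minimal A (toℚ c₀)
    c₀-minimal = Minimal-⊆ A c₀⊆c c-minimal
      where
      c₀⊆c : Support (A ⊛ toℚ c₀) ⊆ Support (A ⊛ c)
      c₀⊆c i = Support-≐ A (≐-sym c≐Kc₀) i ∘′ Support-*v A K≢0 (toℚ c₀) i
    c₀≢0 : NonZeroVec (toℚ c₀)
    c₀≢0 = proj₁ c≢0 , λ c₀ᵢ≡0 → proj₂ c≢0 (trans (c≐Kc₀ _) (trans (cong (K *_) c₀ᵢ≡0) (*-zeroʳ K)))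

  classify : ∀ g → IsCircuit W g → VerticalForm g ⊎ HorizontalForm g ⊎ ParallelForm g
  classify g g-circuit@(_ , g-coprime , _) with lastV (toℚ g) ≟ 0ℚ
  ... | yes t≡0 = inj₂ (inj₁ (horizontal-case g g-circuit t≡0))
  ... | no  t≢0 with any? (λ i → ¬? (fstV (toℚ g) i ≟ 0ℚ))
  ...   | yes c≢0 = inj₂ (inj₂ (parallel-case g g-circuit t≢0 c≢0))
  ...   | no  ¬c≢0 = inj₁ (lastV (toℚ g) , coprime-last-sign g g-coprime c≡0 , ≐-ext c≡0 refl)
    where
    c≡0 : ∀ i → fstV (toℚ g) i ≡ 0ℚ
    c≡0 i = decidable-stable (fstV (toℚ g) i ≟ 0ℚ) (λ cᵢ≢0 → ¬c≢0 (i , cᵢ≢0))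

lemma11 : ∀ (d m : ℕ) (A : Mat m d) (b : Vec m) (f : Fin m)
            (h : Vec d) (η β : ℚ) →
            FullDimensional A b → Irredundant A b →
            IsWedgeCut A b f h η β →
            ∀ (g : ZVec (d ℕ.+ 1)) → IsCircuit (wedgeMat A f h η) g →
              (∃ λ σ → IsSign σ × toℚ g ≐ ext (λ _ → 0ℚ) σ)
            ⊎ (∃ λ c → IsCircuit A c × ∃ λ σ → IsSign σ ×
                 toℚ g ≐ ext (σ *v toℚ c) 0ℚ)
            ⊎ (∃ λ c → IsCircuit A c × ∃ λ σ → IsSign σ ×
                 Σ ℚ λ λq → λq > 0ℚ × ∃ λ w → IsPhi h η (σ *v toℚ c) w ×
                 toℚ g ≐ (λq *v w))
lemma11 d m A b f h η β (p , p-interior) irredundant (_ , P⊆H≤ , P∩H⊆F , F⊆H , w , w-interior , w∈H) =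
  classify
  where
  z₀-others = proj₁ (proj₂ (irredundant f))
  z₀-violates = proj₂ (proj₂ (irredundant f))
  open WedgeGeometry A b f h η β p-interior z₀-others z₀-violates P⊆H≤ P∩H⊆F F⊆H w-interior w∈H
  open WedgeCircuits A f h η η≢0 ker-h⊆ker-a ker-a⊆ker-h
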